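{- Let $a_0,a_2,b_0,b_1,b_2,\lambda\in\mathbb{R}$. Let $[A_{n,k}]_{n,k\ge0}$ satisfy $A_{0,0}=1$, $A_{n,k}=0$ unless $0\le k\le n$, and for $n\ge1$ $$A_{n,k}=(a_0n-\lambda b_1k+a_2)A_{n-1,k}+(b_0n+b_1k+b_2)A_{n-1,k-1}.$$ Let $A_n(q)=\sum_kA_{n,k}q^k$ and define $B_n(q)=A_n(q+\lambda)=\sum_kB_{n,k}q^k$. Then $B_{0,0}=1$, $B_{n,k}=0$ unless $0\le k\le n$, and for $n\ge1$ $$B_{n,k}=[(a_0+\lambda b_0)n+\lambda b_1k+a_2+\lambda(b_1+b_2)]B_{n-1,k}+(b_0n+b_1k+b_2)B_{n-1,k-1}.$$ -}

module Defs where

open import Level using (Level)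
open import Data.Nat using (ℕ; zero; suc)
open import Data.List using (List; []; _∷_; map; upTo)
open import Algebra.Bundles using (CommutativeRing)

-- Everything is developed over an arbitrary commutative ring R
-- (the paper works over ℝ, which agda-stdlib does not provide).
module WithRing {c ℓ : Level} (R : CommutativeRing c ℓ) where
  open CommutativeRing R

  nat : ℕ → Carrier
  nat zero    = 0#
  nat (suc n) = 1# + nat n

  -- polynomials over R as coefficient lists (constant term first)
  Poly : Set c
  Poly = List Carrier

  _⊕_ : Poly → Poly → Poly
  []       ⊕ q        = q
  (a ∷ p)  ⊕ []       = a ∷ p
  (a ∷ p)  ⊕ (b ∷ q)  = (a + b) ∷ (p ⊕ q)

  scale : Carrier → Poly → Poly
  scale c p = map (c *_) p

  coeff : Poly → ℕ → Carrier
  coeff []      _       = 0#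
  coeff (a ∷ p) zero    = a
  coeff (a ∷ p) (suc k) = coeff p k

  -- substitution q ↦ q + λ, via Horner: (c + q·p)(q+λ) = c + (q+λ)·p(q+λ)
  shiftBy : Carrier → Poly → Poly
  shiftBy λ' []      = []
  shiftBy λ' (a ∷ p) = (a ∷ []) ⊕ ((0# ∷ p') ⊕ scale λ' p')
    where p' = shiftBy λ' p

  -- A_n(q) = Σ_{k=0}^{n} A_{n,k} q^k  (A_{n,k} = 0 for k > n)
  rowPoly : (ℕ → ℕ → Carrier) → ℕ → Poly
  rowPoly A n = map (A n) (upTo (suc n))

  Bcoef : (ℕ → ℕ → Carrier) → Carrier → ℕ → ℕ → Carrier
  Bcoef A λ' n k = coeff (shiftBy λ' (rowPoly A n)) k

-- Write θ = q d/dq and D = d/dq.  The recurrence says A_n = (α + βθ)A_{n-1} + (γ + δθ)(q A_{n-1})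
-- with α = a₀n + a₂, β = -λb₁, γ = b₀n + b₂, δ = b₁.  The substitution q ↦ q + λ turns
-- multiplication by q into multiplication by q + λ and θ into θ + λD, so the shifted rows satisfy a
-- recurrence of the same shape plus a term λ(β + λδ)D, which vanishes exactly because β = -λδ.
module Submission where

open import Defs
open import Level using (Level)
open import Data.Nat using (ℕ; zero; suc; _<_; _≤_; s≤s; _≤?_)
open import Data.Nat.Properties using (≰⇒>; m≤n⇒m≤1+n)
open import Data.List using ([]; _∷_; length; applyUpTo)
open import Data.List.Properties using (map-applyUpTo; length-applyUpTo)
open import Data.Product using (_×_; _,_)
open import Relation.Nullary using (yes; no)
open import Relation.Binary.PropositionalEquality as ≡ using (_≡_)
open import Algebra.Bundles using (CommutativeRing)

module Polynomials {c ℓ : Level} (R : CommutativeRing c ℓ) where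
  open CommutativeRing R hiding (zero)
  open WithRing R
  open import Algebra.Solver.Ring.NaturalCoefficients.Default commutativeSemiring
  open import Relation.Binary.Reasoning.Setoid setoid

  infix 4 _≋_
  _≋_ : Poly → Poly → Set ℓ
  p ≋ q = ∀ k → coeff p k ≈ coeff q k

  ∷-cong : ∀ {a b p q} → a ≈ b → p ≋ q → (a ∷ p) ≋ (b ∷ q)
  ∷-cong a≈b p≋q zero    = a≈b
  ∷-cong a≈b p≋q (suc k) = p≋q k

  ∷-vanishes : ∀ {a p} → a ≈ 0# → p ≋ [] → (a ∷ p) ≋ []
  ∷-vanishes a≈0 p≋0 zero    = a≈0
  ∷-vanishes a≈0 p≋0 (suc k) = p≋0 k

  coeff-⊕ : ∀ p q k → coeff (p ⊕ q) k ≈ coeff p k + coeff q k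
  coeff-⊕ []      q       k       = sym (+-identityˡ _)
  coeff-⊕ (a ∷ p) []      zero    = sym (+-identityʳ _)
  coeff-⊕ (a ∷ p) []      (suc k) = sym (+-identityʳ _)
  coeff-⊕ (a ∷ p) (b ∷ q) zero    = refl
  coeff-⊕ (a ∷ p) (b ∷ q) (suc k) = coeff-⊕ p q k

  coeff-scale : ∀ x p k → coeff (scale x p) k ≈ x * coeff p k
  coeff-scale x []      k       = sym (zeroʳ x)
  coeff-scale x (a ∷ p) zero    = refl
  coeff-scale x (a ∷ p) (suc k) = coeff-scale x p k

  -- The Euler operator θ = q d/dq, computed by θ(a + q p) = q (p + θ p).
  euler : Poly → Poly
  euler []      = []
  euler (a ∷ p) = 0# ∷ (p ⊕ euler p)

  coeff-euler : ∀ p k → coeff (euler p) k ≈ nat k * coeff p k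
  coeff-euler []      k       = sym (zeroʳ _)
  coeff-euler (a ∷ p) zero    = sym (zeroˡ a)
  coeff-euler (a ∷ p) (suc k) = begin
    coeff (p ⊕ euler p) k              ≈⟨ coeff-⊕ p (euler p) k ⟩
    coeff p k + coeff (euler p) k      ≈⟨ +-congˡ (coeff-euler p k) ⟩
    coeff p k + nat k * coeff p k      ≈⟨ solve 2 (λ m x → x :+ m :* x := (con 1 :+ m) :* x) refl (nat k) (coeff p k) ⟩
    (1# + nat k) * coeff p k           ∎

  coeff-applyUpTo : ∀ (f : ℕ → Carrier) {m k} → k < m → coeff (applyUpTo f m) k ≡ f k
  coeff-applyUpTo f {suc m} {zero}  _       = ≡.refl
  coeff-applyUpTo f {suc m} {suc k} (s≤s k<m) = coeff-applyUpTo (λ i → f (suc i)) k<m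

  coeff-applyUpTo-≥ : ∀ (f : ℕ → Carrier) {m k} → m ≤ k → coeff (applyUpTo f m) k ≡ 0#
  coeff-applyUpTo-≥ f {zero}          _         = ≡.refl
  coeff-applyUpTo-≥ f {suc m} {suc k} (s≤s m≤k) = coeff-applyUpTo-≥ (λ i → f (suc i)) m≤k

  rowPoly≡applyUpTo : ∀ A n → rowPoly A n ≡ applyUpTo (A n) (suc n)
  rowPoly≡applyUpTo A n = map-applyUpTo (λ i → i) (A n) (suc n)

  coeff-rowPoly : ∀ A n → (∀ k → n < k → A n k ≈ 0#) → ∀ k → coeff (rowPoly A n) k ≈ A n k
  coeff-rowPoly A n vanish k rewrite rowPoly≡applyUpTo A n with k ≤? n
  ... | yes k≤n = reflexive (coeff-applyUpTo (A n) (s≤s k≤n))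
  ... | no  k≰n = trans (reflexive (coeff-applyUpTo-≥ (A n) (≰⇒> k≰n))) (sym (vanish k (≰⇒> k≰n)))

  length-rowPoly : ∀ A n → length (rowPoly A n) ≡ suc n
  length-rowPoly A n = ≡.trans (≡.cong length (rowPoly≡applyUpTo A n)) (length-applyUpTo (A n) (suc n))

  -- r = (α + βθ) p + (γ + δθ)(q p), written coefficientwise; coeff (0# ∷ p) k is the coefficient of q^(k-1) in p.
  record Recurrence (α β γ δ : Carrier) (p r : Poly) : Set ℓ where
    field
      coeff-recurrence : ∀ k → coeff r k ≈ (α + β * nat k) * coeff p k + (γ + δ * nat k) * coeff (0# ∷ p) k
  open Recurrence public

  recurrenceStep : (α β γ δ : Carrier) → Poly → Poly
  recurrenceStep α β γ δ p = (scale α p ⊕ scale β (euler p)) ⊕ (scale γ (0# ∷ p) ⊕ scale δ (euler (0# ∷ p)))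

  recurrenceStep-recurrence : ∀ α β γ δ p → Recurrence α β γ δ p (recurrenceStep α β γ δ p)
  recurrenceStep-recurrence α β γ δ p .coeff-recurrence k = begin
    coeff (recurrenceStep α β γ δ p) k
      ≈⟨ coeff-⊕ (scale α p ⊕ scale β (euler p)) (scale γ (0# ∷ p) ⊕ scale δ (euler (0# ∷ p))) k ⟩
    coeff (scale α p ⊕ scale β (euler p)) k + coeff (scale γ (0# ∷ p) ⊕ scale δ (euler (0# ∷ p))) k
      ≈⟨ +-cong (coeff-⊕ (scale α p) (scale β (euler p)) k) (coeff-⊕ (scale γ (0# ∷ p)) (scale δ (euler (0# ∷ p))) k) ⟩
    (coeff (scale α p) k + coeff (scale β (euler p)) k) + (coeff (scale γ (0# ∷ p)) k + coeff (scale δ (euler (0# ∷ p))) k)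
      ≈⟨ +-cong (+-cong (coeff-scale α p k) (trans (coeff-scale β (euler p) k) (*-congˡ (coeff-euler p k))))
                (+-cong (coeff-scale γ (0# ∷ p) k) (trans (coeff-scale δ (euler (0# ∷ p)) k) (*-congˡ (coeff-euler (0# ∷ p) k)))) ⟩
    (α * x + β * (m * x)) + (γ * z + δ * (m * z))
      ≈⟨ solve 7 (λ α β γ δ m x z → (α :* x :+ β :* (m :* x)) :+ (γ :* z :+ δ :* (m :* z))
                                   := (α :+ β :* m) :* x :+ (γ :+ δ :* m) :* z) refl α β γ δ m x z ⟩
    (α + β * m) * x + (γ + δ * m) * z
      ∎
    where
    m = nat k
    x = coeff p k
    z = coeff (0# ∷ p) k

  recurrence-unique : ∀ {α β γ δ p r r′} → Recurrence α β γ δ p r → Recurrence α β γ δ p r′ → r ≋ r′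
  recurrence-unique rec rec′ k = trans (coeff-recurrence rec k) (sym (coeff-recurrence rec′ k))

  recurrence-zero : ∀ {α β γ δ p r} → Recurrence α β γ δ p r → coeff r 0 ≈ (α + β * nat 0) * coeff p 0
  recurrence-zero {γ = γ} {δ} rec = trans (coeff-recurrence rec 0) (trans (+-congˡ (zeroʳ (γ + δ * nat 0))) (+-identityʳ _))

  rowPoly-recurrence : ∀ {α β γ δ} A n → (∀ n k → n < k → A n k ≈ 0#) →
    A (suc n) 0 ≈ (α + β * nat 0) * A n 0 →
    (∀ k → A (suc n) (suc k) ≈ (α + β * nat (suc k)) * A n (suc k) + (γ + δ * nat (suc k)) * A n k) →
    Recurrence α β γ δ (rowPoly A n) (rowPoly A (suc n))
  rowPoly-recurrence {α} {β} {γ} {δ} A n vanish rec₀ rec₊ .coeff-recurrence zero = begin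
    coeff (rowPoly A (suc n)) 0                                 ≈⟨ row (suc n) 0 ⟩
    A (suc n) 0                                                 ≈⟨ rec₀ ⟩
    (α + β * nat 0) * A n 0                                     ≈⟨ *-congˡ (sym (row n 0)) ⟩
    (α + β * nat 0) * coeff (rowPoly A n) 0                     ≈⟨ sym (+-identityʳ _) ⟩
    (α + β * nat 0) * coeff (rowPoly A n) 0 + 0#                ≈⟨ +-congˡ (sym (zeroʳ (γ + δ * nat 0))) ⟩
    (α + β * nat 0) * coeff (rowPoly A n) 0 + (γ + δ * nat 0) * 0# ∎
    where row = λ n → coeff-rowPoly A n (vanish n)
  rowPoly-recurrence A n vanish rec₀ rec₊ .coeff-recurrence (suc k) =
    trans (row (suc n) (suc k)) (trans (rec₊ k) (sym (+-cong (*-congˡ (row n (suc k))) (*-congˡ (row n k)))))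
    where row = λ n → coeff-rowPoly A n (vanish n)

  module _ (l : Carrier) where

    coeff-shiftBy-∷ : ∀ a p k → coeff (shiftBy l (a ∷ p)) k ≈ coeff (a ∷ shiftBy l p) k + l * coeff (shiftBy l p) k
    coeff-shiftBy-∷ a p k = begin
      coeff ((a ∷ []) ⊕ ((0# ∷ p′) ⊕ scale l p′)) k              ≈⟨ coeff-⊕ (a ∷ []) ((0# ∷ p′) ⊕ scale l p′) k ⟩
      coeff (a ∷ []) k + coeff ((0# ∷ p′) ⊕ scale l p′) k        ≈⟨ +-congˡ (trans (coeff-⊕ (0# ∷ p′) (scale l p′) k) (+-congˡ (coeff-scale l p′ k))) ⟩
      coeff (a ∷ []) k + (coeff (0# ∷ p′) k + l * coeff p′ k)    ≈⟨ sym (+-assoc _ _ _) ⟩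
      (coeff (a ∷ []) k + coeff (0# ∷ p′) k) + l * coeff p′ k    ≈⟨ +-congʳ (head+tail k) ⟩
      coeff (a ∷ p′) k + l * coeff p′ k                          ∎
      where
      p′ = shiftBy l p
      head+tail : ∀ k → coeff (a ∷ []) k + coeff (0# ∷ p′) k ≈ coeff (a ∷ p′) k
      head+tail zero    = +-identityʳ a
      head+tail (suc k) = +-identityˡ _

    shiftBy-vanishes : ∀ p → p ≋ [] → shiftBy l p ≋ []
    shiftBy-vanishes []      _   k = refl
    shiftBy-vanishes (a ∷ p) a∷p≋0 k = begin
      coeff (shiftBy l (a ∷ p)) k                     ≈⟨ coeff-shiftBy-∷ a p k ⟩
      coeff (a ∷ shiftBy l p) k + l * coeff (shiftBy l p) k
        ≈⟨ +-cong (∷-vanishes (a∷p≋0 0) Sp≋0 k) (*-congˡ (Sp≋0 k)) ⟩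
      0# + l * 0#                                     ≈⟨ trans (+-identityˡ _) (zeroʳ l) ⟩
      0#                                              ∎
      where Sp≋0 = shiftBy-vanishes p (λ k → a∷p≋0 (suc k))

    shiftBy-cong : ∀ p q → p ≋ q → shiftBy l p ≋ shiftBy l q
    shiftBy-cong []      q       p≋q = λ k → sym (shiftBy-vanishes q (λ k → sym (p≋q k)) k)
    shiftBy-cong (a ∷ p) []      p≋q = shiftBy-vanishes (a ∷ p) p≋q
    shiftBy-cong (a ∷ p) (b ∷ q) p≋q k = begin
      coeff (shiftBy l (a ∷ p)) k                               ≈⟨ coeff-shiftBy-∷ a p k ⟩
      coeff (a ∷ shiftBy l p) k + l * coeff (shiftBy l p) k     ≈⟨ +-cong (∷-cong (p≋q 0) tails k) (*-congˡ (tails k)) ⟩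
      coeff (b ∷ shiftBy l q) k + l * coeff (shiftBy l q) k     ≈⟨ sym (coeff-shiftBy-∷ b q k) ⟩
      coeff (shiftBy l (b ∷ q)) k                               ∎
      where tails = shiftBy-cong p q (λ k → p≋q (suc k))

    coeff-shiftBy-⊕ : ∀ p q k → coeff (shiftBy l (p ⊕ q)) k ≈ coeff (shiftBy l p) k + coeff (shiftBy l q) k
    coeff-shiftBy-⊕ []      q       k = sym (+-identityˡ _)
    coeff-shiftBy-⊕ (a ∷ p) []      k = sym (+-identityʳ _)
    coeff-shiftBy-⊕ (a ∷ p) (b ∷ q) k = begin
      coeff (shiftBy l ((a + b) ∷ (p ⊕ q))) k
        ≈⟨ coeff-shiftBy-∷ (a + b) (p ⊕ q) k ⟩
      coeff ((a + b) ∷ shiftBy l (p ⊕ q)) k + l * coeff (shiftBy l (p ⊕ q)) k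
        ≈⟨ +-cong (∷-cong refl tails k) (*-congˡ (tails k)) ⟩
      coeff ((a ∷ Sp) ⊕ (b ∷ Sq)) k + l * coeff (Sp ⊕ Sq) k
        ≈⟨ +-cong (coeff-⊕ (a ∷ Sp) (b ∷ Sq) k) (*-congˡ (coeff-⊕ Sp Sq k)) ⟩
      (coeff (a ∷ Sp) k + coeff (b ∷ Sq) k) + l * (coeff Sp k + coeff Sq k)
        ≈⟨ solve 5 (λ l u v y z → (u :+ v) :+ l :* (y :+ z) := (u :+ l :* y) :+ (v :+ l :* z)) refl l _ _ _ _ ⟩
      (coeff (a ∷ Sp) k + l * coeff Sp k) + (coeff (b ∷ Sq) k + l * coeff Sq k)
        ≈⟨ sym (+-cong (coeff-shiftBy-∷ a p k) (coeff-shiftBy-∷ b q k)) ⟩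
      coeff (shiftBy l (a ∷ p)) k + coeff (shiftBy l (b ∷ q)) k
        ∎
      where
      Sp = shiftBy l p
      Sq = shiftBy l q
      tails : shiftBy l (p ⊕ q) ≋ Sp ⊕ Sq
      tails j = trans (coeff-shiftBy-⊕ p q j) (sym (coeff-⊕ Sp Sq j))

    coeff-shiftBy-scale : ∀ x p k → coeff (shiftBy l (scale x p)) k ≈ x * coeff (shiftBy l p) k
    coeff-shiftBy-scale x []      k = sym (zeroʳ x)
    coeff-shiftBy-scale x (a ∷ p) k = begin
      coeff (shiftBy l ((x * a) ∷ scale x p)) k
        ≈⟨ coeff-shiftBy-∷ (x * a) (scale x p) k ⟩
      coeff ((x * a) ∷ shiftBy l (scale x p)) k + l * coeff (shiftBy l (scale x p)) k
        ≈⟨ +-cong (∷-cong refl tails k) (*-congˡ (tails k)) ⟩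
      coeff (scale x (a ∷ Sp)) k + l * coeff (scale x Sp) k
        ≈⟨ +-cong (coeff-scale x (a ∷ Sp) k) (*-congˡ (coeff-scale x Sp k)) ⟩
      x * coeff (a ∷ Sp) k + l * (x * coeff Sp k)
        ≈⟨ solve 4 (λ l x u y → x :* u :+ l :* (x :* y) := x :* (u :+ l :* y)) refl l x _ _ ⟩
      x * (coeff (a ∷ Sp) k + l * coeff Sp k)
        ≈⟨ *-congˡ (sym (coeff-shiftBy-∷ a p k)) ⟩
      x * coeff (shiftBy l (a ∷ p)) k
        ∎
      where
      Sp = shiftBy l p
      tails : shiftBy l (scale x p) ≋ scale x Sp
      tails j = trans (coeff-shiftBy-scale x p j) (sym (coeff-scale x Sp j))

    -- Shifting conjugates θ into θ + λD, since (θp)(q + λ) = (q + λ) p′(q + λ).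
    coeff-shiftBy-euler : ∀ p k → coeff (shiftBy l (euler p)) k
                                   ≈ nat k * coeff (shiftBy l p) k + l * (nat (suc k) * coeff (shiftBy l p) (suc k))
    coeff-shiftBy-euler [] k =
      solve 3 (λ l m m′ → con 0 := m :* con 0 :+ l :* (m′ :* con 0)) refl l (nat k) (nat (suc k))
    coeff-shiftBy-euler (a ∷ p) = shifted
      where
      y : ℕ → Carrier
      y = coeff (shiftBy l p)
      tail : ∀ j → coeff (shiftBy l (p ⊕ euler p)) j ≈ y j + (nat j * y j + l * (nat (suc j) * y (suc j)))
      tail j = trans (coeff-shiftBy-⊕ p (euler p) j) (+-congˡ (coeff-shiftBy-euler p j))
      shifted : ∀ k → coeff (shiftBy l (0# ∷ (p ⊕ euler p))) k
                      ≈ nat k * coeff (shiftBy l (a ∷ p)) k + l * (nat (suc k) * coeff (shiftBy l (a ∷ p)) (suc k))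
      shifted zero = begin
        coeff (shiftBy l (0# ∷ (p ⊕ euler p))) 0
          ≈⟨ coeff-shiftBy-∷ 0# (p ⊕ euler p) 0 ⟩
        0# + l * coeff (shiftBy l (p ⊕ euler p)) 0
          ≈⟨ +-congˡ (*-congˡ (tail 0)) ⟩
        0# + l * (y 0 + (0# * y 0 + l * ((1# + 0#) * y 1)))
          ≈⟨ solve 4 (λ l a y₀ y₁ → con 0 :+ l :* (y₀ :+ (con 0 :* y₀ :+ l :* ((con 1 :+ con 0) :* y₁)))
                                  := con 0 :* (a :+ l :* y₀) :+ l :* ((con 1 :+ con 0) :* (y₀ :+ l :* y₁))) refl l a (y 0) (y 1) ⟩
        0# * (a + l * y 0) + l * ((1# + 0#) * (y 0 + l * y 1))
          ≈⟨ sym (+-cong (*-congˡ (coeff-shiftBy-∷ a p 0)) (*-congˡ (*-congˡ (coeff-shiftBy-∷ a p 1)))) ⟩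
        0# * coeff (shiftBy l (a ∷ p)) 0 + l * ((1# + 0#) * coeff (shiftBy l (a ∷ p)) 1)
          ∎
      shifted (suc j) = begin
        coeff (shiftBy l (0# ∷ (p ⊕ euler p))) (suc j)
          ≈⟨ coeff-shiftBy-∷ 0# (p ⊕ euler p) (suc j) ⟩
        coeff (shiftBy l (p ⊕ euler p)) j + l * coeff (shiftBy l (p ⊕ euler p)) (suc j)
          ≈⟨ +-cong (tail j) (*-congˡ (tail (suc j))) ⟩
        (y j + (m * y j + l * (m₁ * y₁))) + l * (y₁ + (m₁ * y₁ + l * (m₂ * y₂)))
          ≈⟨ solve 5 (λ l m y₀ y₁ y₂ →
               (y₀ :+ (m :* y₀ :+ l :* ((con 1 :+ m) :* y₁))) :+ l :* (y₁ :+ ((con 1 :+ m) :* y₁ :+ l :* ((con 1 :+ (con 1 :+ m)) :* y₂)))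
               := (con 1 :+ m) :* (y₀ :+ l :* y₁) :+ l :* ((con 1 :+ (con 1 :+ m)) :* (y₁ :+ l :* y₂))) refl l m (y j) y₁ y₂ ⟩
        m₁ * (y j + l * y₁) + l * (m₂ * (y₁ + l * y₂))
          ≈⟨ sym (+-cong (*-congˡ (coeff-shiftBy-∷ a p (suc j))) (*-congˡ (*-congˡ (coeff-shiftBy-∷ a p (suc (suc j)))))) ⟩
        m₁ * coeff (shiftBy l (a ∷ p)) (suc j) + l * (m₂ * coeff (shiftBy l (a ∷ p)) (suc (suc j)))
          ∎
        where
        m = nat j
        m₁ = nat (suc j)
        m₂ = nat (suc (suc j))
        y₁ = y (suc j)
        y₂ = y (suc (suc j))

    coeff-shiftBy-≥ : ∀ p {k} → length p ≤ k → coeff (shiftBy l p) k ≈ 0#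
    coeff-shiftBy-≥ []      _ = refl
    coeff-shiftBy-≥ (a ∷ p) {suc k} (s≤s p≤k) = begin
      coeff (shiftBy l (a ∷ p)) (suc k)                         ≈⟨ coeff-shiftBy-∷ a p (suc k) ⟩
      coeff (shiftBy l p) k + l * coeff (shiftBy l p) (suc k)   ≈⟨ +-cong (coeff-shiftBy-≥ p p≤k) (*-congˡ (coeff-shiftBy-≥ p (m≤n⇒m≤1+n p≤k))) ⟩
      0# + l * 0#                                               ≈⟨ trans (+-identityˡ _) (zeroʳ l) ⟩
      0#                                                        ∎

    coeff-shiftBy-recurrenceStep : ∀ α β γ δ p k →
      coeff (shiftBy l (recurrenceStep α β γ δ p)) k
        ≈ (α * coeff (shiftBy l p) k + β * coeff (shiftBy l (euler p)) k)
          + (γ * coeff (shiftBy l (0# ∷ p)) k + δ * coeff (shiftBy l (euler (0# ∷ p))) k)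
    coeff-shiftBy-recurrenceStep α β γ δ p k = begin
      coeff (shiftBy l ((αp ⊕ βθp) ⊕ (γqp ⊕ δθqp))) k
        ≈⟨ coeff-shiftBy-⊕ (αp ⊕ βθp) (γqp ⊕ δθqp) k ⟩
      coeff (shiftBy l (αp ⊕ βθp)) k + coeff (shiftBy l (γqp ⊕ δθqp)) k
        ≈⟨ +-cong (coeff-shiftBy-⊕ αp βθp k) (coeff-shiftBy-⊕ γqp δθqp k) ⟩
      (coeff (shiftBy l αp) k + coeff (shiftBy l βθp) k) + (coeff (shiftBy l γqp) k + coeff (shiftBy l δθqp) k)
        ≈⟨ +-cong (+-cong (coeff-shiftBy-scale α p k) (coeff-shiftBy-scale β (euler p) k))
                  (+-cong (coeff-shiftBy-scale γ (0# ∷ p) k) (coeff-shiftBy-scale δ (euler (0# ∷ p)) k)) ⟩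
      (α * coeff (shiftBy l p) k + β * coeff (shiftBy l (euler p)) k)
        + (γ * coeff (shiftBy l (0# ∷ p)) k + δ * coeff (shiftBy l (euler (0# ∷ p))) k)
        ∎
      where
      αp   = scale α p
      βθp  = scale β (euler p)
      γqp  = scale γ (0# ∷ p)
      δθqp = scale δ (euler (0# ∷ p))

    coeff-shiftBy-recurrence : ∀ {α β γ δ p r} → Recurrence α β γ δ p r → ∀ k →
      coeff (shiftBy l r) k
        ≈ (((α + l * (γ + δ)) + ((β + l * δ) + l * δ) * nat k) * coeff (shiftBy l p) k
           + (γ + δ * nat k) * coeff (0# ∷ shiftBy l p) k)
          + l * (β + l * δ) * (nat (suc k) * coeff (shiftBy l p) (suc k))
    coeff-shiftBy-recurrence {α} {β} {γ} {δ} {p} {r} rec k = begin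
      coeff (shiftBy l r) k
        ≈⟨ shiftBy-cong r (recurrenceStep α β γ δ p) (recurrence-unique rec (recurrenceStep-recurrence α β γ δ p)) k ⟩
      coeff (shiftBy l (recurrenceStep α β γ δ p)) k
        ≈⟨ coeff-shiftBy-recurrenceStep α β γ δ p k ⟩
      (α * coeff (shiftBy l p) k + β * coeff (shiftBy l (euler p)) k)
        + (γ * coeff (shiftBy l (0# ∷ p)) k + δ * coeff (shiftBy l (euler (0# ∷ p))) k)
        ≈⟨ +-cong (+-congˡ (*-congˡ (coeff-shiftBy-euler p k)))
                  (+-cong (*-congˡ qy) (*-congˡ (trans (coeff-shiftBy-euler (0# ∷ p) k) (+-cong (*-congˡ qy) (*-congˡ (*-congˡ qy′)))))) ⟩
      (α * y₀ + β * (m * y₀ + l * ((1# + m) * y₁)))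
        + (γ * (z + l * y₀) + δ * (m * (z + l * y₀) + l * ((1# + m) * (y₀ + l * y₁))))
        ≈⟨ solve 9 (λ l α β γ δ m z y₀ y₁ →
             (α :* y₀ :+ β :* (m :* y₀ :+ l :* ((con 1 :+ m) :* y₁)))
               :+ (γ :* (z :+ l :* y₀) :+ δ :* (m :* (z :+ l :* y₀) :+ l :* ((con 1 :+ m) :* (y₀ :+ l :* y₁))))
             := (((α :+ l :* (γ :+ δ)) :+ ((β :+ l :* δ) :+ l :* δ) :* m) :* y₀ :+ (γ :+ δ :* m) :* z)
                :+ l :* (β :+ l :* δ) :* ((con 1 :+ m) :* y₁))
             refl l α β γ δ m z y₀ y₁ ⟩
      (((α + l * (γ + δ)) + ((β + l * δ) + l * δ) * m) * y₀ + (γ + δ * m) * z) + l * (β + l * δ) * ((1# + m) * y₁)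
        ∎
      where
      m  = nat k
      y₀ = coeff (shiftBy l p) k
      y₁ = coeff (shiftBy l p) (suc k)
      z  = coeff (0# ∷ shiftBy l p) k
      qy : coeff (shiftBy l (0# ∷ p)) k ≈ z + l * y₀
      qy = coeff-shiftBy-∷ 0# p k
      qy′ : coeff (shiftBy l (0# ∷ p)) (suc k) ≈ y₀ + l * y₁
      qy′ = coeff-shiftBy-∷ 0# p (suc k)

    shiftBy-recurrence : ∀ {α β γ δ p r} → β + l * δ ≈ 0# → Recurrence α β γ δ p r →
                         Recurrence (α + l * (γ + δ)) (l * δ) γ δ (shiftBy l p) (shiftBy l r)
    shiftBy-recurrence {α} {β} {γ} {δ} {p} {r} β+lδ≈0 rec .coeff-recurrence k = begin
      coeff (shiftBy l r) k
        ≈⟨ coeff-shiftBy-recurrence rec k ⟩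
      ((α′ + ((β + l * δ) + l * δ) * nat k) * y + (γ + δ * nat k) * z) + l * (β + l * δ) * D
        ≈⟨ +-cong (+-congʳ (*-congʳ (+-congˡ (*-congʳ (trans (+-congʳ β+lδ≈0) (+-identityˡ _))))))
                  (trans (*-congʳ (trans (*-congˡ β+lδ≈0) (zeroʳ l))) (zeroˡ D)) ⟩
      ((α′ + l * δ * nat k) * y + (γ + δ * nat k) * z) + 0#
        ≈⟨ +-identityʳ _ ⟩
      (α′ + l * δ * nat k) * y + (γ + δ * nat k) * z
        ∎
      where
      α′ = α + l * (γ + δ)
      y  = coeff (shiftBy l p) k
      z  = coeff (0# ∷ shiftBy l p) k
      D  = nat (suc k) * coeff (shiftBy l p) (suc k)

lemma4p1 : ∀ {c ℓ : Level} (R : CommutativeRing c ℓ) →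
    let open CommutativeRing R hiding (zero)
        open WithRing R
    in (a₀ a₂ b₀ b₁ b₂ λ' : Carrier) (A : ℕ → ℕ → Carrier) →
       A 0 0 ≈ 1# →
       (∀ n k → n < k → A n k ≈ 0#) →
       (∀ n → A (suc n) 0 ≈ ((a₀ * nat (suc n) - λ' * b₁ * nat 0) + a₂) * A n 0) →
       (∀ n k → A (suc n) (suc k) ≈
          ((a₀ * nat (suc n) - λ' * b₁ * nat (suc k)) + a₂) * A n (suc k)
          + ((b₀ * nat (suc n) + b₁ * nat (suc k)) + b₂) * A n k) →
       let B = Bcoef A λ' in
       (B 0 0 ≈ 1#)
       × (∀ n k → n < k → B n k ≈ 0#)
       × (∀ n → B (suc n) 0 ≈
            ((((a₀ + λ' * b₀) * nat (suc n) + λ' * b₁ * nat 0) + a₂) + λ' * (b₁ + b₂)) * B n 0)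
       × (∀ n k → B (suc n) (suc k) ≈
            ((((a₀ + λ' * b₀) * nat (suc n) + λ' * b₁ * nat (suc k)) + a₂) + λ' * (b₁ + b₂)) * B n (suc k)
            + ((b₀ * nat (suc n) + b₁ * nat (suc k)) + b₂) * B n k)
lemma4p1 R a₀ a₂ b₀ b₁ b₂ λ' A A₀₀≈1 vanish rec₀ rec₊ =
  B₀₀≈1
  , B-vanish
  , (λ n → trans (recurrence-zero (shifted n)) (*-congʳ (α-shifted n 0)))
  , (λ n k → trans (coeff-recurrence (shifted n) (suc k))
                   (+-cong (*-congʳ (α-shifted n (suc k))) (*-congʳ (sym (γ-row n (suc k))))))
  where
  open CommutativeRing R hiding (zero)
  open WithRing R
  open Polynomials R
  open import Algebra.Properties.Ring ring using (-‿distribˡ-*)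
  open import Algebra.Properties.CommutativeSemigroup +-commutativeSemigroup using (xy∙z≈xz∙y)
  open import Algebra.Solver.Ring.NaturalCoefficients.Default commutativeSemiring

  α γ : ℕ → Carrier
  α n = a₀ * nat (suc n) + a₂
  γ n = b₀ * nat (suc n) + b₂

  α-row : ∀ n k → (a₀ * nat (suc n) - λ' * b₁ * nat k) + a₂ ≈ α n + - (λ' * b₁) * nat k
  α-row n k = trans (+-congʳ (+-congˡ (-‿distribˡ-* (λ' * b₁) (nat k)))) (xy∙z≈xz∙y _ _ a₂)

  γ-row : ∀ n k → (b₀ * nat (suc n) + b₁ * nat k) + b₂ ≈ γ n + b₁ * nat k
  γ-row n k = xy∙z≈xz∙y _ _ b₂

  α-shifted : ∀ n k → (α n + λ' * (γ n + b₁)) + λ' * b₁ * nat k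
                      ≈ (((a₀ + λ' * b₀) * nat (suc n) + λ' * b₁ * nat k) + a₂) + λ' * (b₁ + b₂)
  α-shifted n k = solve 8 (λ a₀ a₂ b₀ b₁ b₂ l N m → ((a₀ :* N :+ a₂) :+ l :* ((b₀ :* N :+ b₂) :+ b₁)) :+ l :* b₁ :* m
                                 := (((a₀ :+ l :* b₀) :* N :+ l :* b₁ :* m) :+ a₂) :+ l :* (b₁ :+ b₂))
                          refl a₀ a₂ b₀ b₁ b₂ λ' (nat (suc n)) (nat k)

  shifted : ∀ n → Recurrence (α n + λ' * (γ n + b₁)) (λ' * b₁) (γ n) b₁
                             (shiftBy λ' (rowPoly A n)) (shiftBy λ' (rowPoly A (suc n)))
  shifted n = shiftBy-recurrence λ' (-‿inverseˡ (λ' * b₁)) (rowPoly-recurrence A n vanish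
    (trans (rec₀ n) (*-congʳ (α-row n 0)))
    (λ k → trans (rec₊ n k) (+-cong (*-congʳ (α-row n (suc k))) (*-congʳ (γ-row n (suc k))))))

  B₀₀≈1 : Bcoef A λ' 0 0 ≈ 1#
  B₀₀≈1 = trans (coeff-shiftBy-∷ λ' (A 0 0) [] 0) (trans (+-congˡ (zeroʳ λ')) (trans (+-identityʳ _) A₀₀≈1))

  B-vanish : ∀ n k → n < k → Bcoef A λ' n k ≈ 0#
  B-vanish n k n<k = coeff-shiftBy-≥ λ' (rowPoly A n) (≡.subst (_≤ k) (≡.sym (length-rowPoly A n)) n<k)
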